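{- Let $K$ be a commutative $\mathbb{Q}$-algebra, $D$ a set, and $(c_{n,d})_{n\ge0,d\in D}$ elements of $K$. Let $\sigma:\mathcal{H}(D)\to K$ be the linear map given on a $D$-decorated rooted tree $t$ by \[ \sigma(t)=\sum_{\tau\in\mathrm{Tub}(t)}c_{b(\tau)-1,\,d(\operatorname{rt}(t))}\,c(\tau), \] and vanishing on the empty forest and on all forests with at least two components. Then for every tree $t$ and every $k\ge1$, \[ \sigma^{*k}(t)=\sum_{\tau\in\mathrm{Tub}(t),\ b(\tau)\ge k}c_{b(\tau)-k,\,d(\operatorname{rt}(t))}\,c(\tau). \]
   Context: $\mathcal{H}(D)$ is the free commutative $K$-algebra on $D$-decorated rooted trees (basis: forests; $1$ = empty forest) with coproduct given on a tree $t$ by $\Delta t=\sum_f f\otimes(t\setminus f)$, where $f$ ranges over rooted subforests of $t$ (disjoint unions of rooted subtrees, a rooted subtree being a vertex with all its descendants; including the empty forest and $t$ itself), extended multiplicatively; counit $\varepsilon$ is $1$ on the empty forest and $0$ on other forests. Convolution: $\alpha*\beta=m_K(\alpha\otimes\beta)\Delta$. A tube is a set of vertices inducing a connected subgraph; a binary tubing $\tau$ of $t$ is a set of tubes containing $V(t)$ in which each tube is a single vertex or is partitioned by two other tubes; $\mathrm{Tub}(t)$ is the set of them. $b(v,\tau)$ is the number of tubes whose root (vertex nearest $\operatorname{rt}(t)$) is $v$; $b(\tau)=b(\operatorname{rt}(t),\tau)$; $c(\tau)=\prod_{v\ne\operatorname{rt}(t)}c_{b(v,\tau)-1,\,d(v)}$.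 -}

module Defs where

open import Level using (Level; _⊔_)
open import Data.Nat using (ℕ; zero; suc; _∸_; _≟_)
open import Data.List using (List; []; _∷_; _++_; map; concatMap; concat; filter; length)
open import Data.Product using (_×_; _,_; proj₁; proj₂; Σ)
open import Relation.Nullary using (yes; no)
open import Relation.Binary.PropositionalEquality using (_≡_)
open import Algebra.Bundles using (CommutativeRing)
open import Algebra.Morphism.Structures using (module RingMorphisms)
open import Data.Rational using (ℚ)
import Data.Rational.Properties as ℚP

QAlgebra : ∀ {a ℓ} → CommutativeRing a ℓ → Set (a ⊔ ℓ)
QAlgebra R = Σ (ℚ → Carrier) (λ ι → IsRingHomomorphism ι)
  where
  open CommutativeRing R using (Carrier; rawRing)
  open RingMorphisms ℚP.+-*-rawRing rawRing using (IsRingHomomorphism)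

-- A tree is represented by a planar
-- representative (children in a list); every quantity below only depends
-- on the isomorphism class of the tree.  A forest (basis element of H(D),
-- a monomial in trees) is represented by a list of trees; [] is the empty
-- forest 1.

data Tree {d} (D : Set d) : Set d where
  node : D → List (Tree D) → Tree D

Forest : ∀ {d} → Set d → Set d
Forest D = List (Tree D)

module _ {d} {D : Set d} where

  mutual
    sizeT : Tree D → ℕ
    sizeT (node _ ts) = suc (sizeF ts)

    sizeF : Forest D → ℕ
    sizeF [] = 0
    sizeF (t ∷ ts) = sizeT t Data.Nat.+ sizeF ts

  -- Coproduct.  cutsT t lists, for every rooted subforest f of t (a set of
  -- vertices closed under taking descendants, including ∅ and t), the pair
  -- (f , t ∖ f); t ∖ f is the empty forest or a single tree.
  -- cutsF F does the same for a forest F; this is Δ extended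
  -- multiplicatively:  Δ F = Σ_{(f,u) ∈ cutsF F} f ⊗ u.

  mutual
    cutsT : Tree D → List (Forest D × Forest D)
    cutsT (node x ts) =
      (node x ts ∷ [] , []) ∷
      map (λ p → (proj₁ p , node x (proj₂ p) ∷ [])) (cutsF ts)

    cutsF : Forest D → List (Forest D × Forest D)
    cutsF [] = ([] , []) ∷ []
    cutsF (t ∷ ts) =
      concatMap (λ p → map (λ q → (proj₁ p ++ proj₁ q , proj₂ p ++ proj₂ q))
                            (cutsF ts))
                (cutsT t)

  -- Vertices: label every vertex of a tree by its preorder index, so that
  -- vertices have an identity (label 0 is the root rt(t)).

  mutual
    labelT : ℕ → Tree D → Tree (ℕ × D) × ℕ
    labelT n (node x ts) with labelF (suc n) ts
    ... | (us , m) = (node (n , x) us , m)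

    labelF : ℕ → Forest D → Forest (ℕ × D) × ℕ
    labelF n [] = ([] , n)
    labelF n (t ∷ ts) with labelT n t
    ... | (u , m) with labelF m ts
    ...   | (us , k) = (u ∷ us , k)

  labelled : Tree D → Tree (ℕ × D)
  labelled t = proj₁ (labelT 0 t)

module _ {a} {A : Set a} where

  rootLabel : Tree A → A
  rootLabel (node x _) = x

  mutual
    verticesT : Tree A → List A
    verticesT (node x ts) = x ∷ verticesF ts

    verticesF : Forest A → List A
    verticesF [] = []
    verticesF (t ∷ ts) = verticesT t ++ verticesF ts

  -- All ways of cutting exactly one edge of a tree T: pairs
  -- (upper tube containing the root of T , lower tube).  These are exactly
  -- the partitions of V(T) into two tubes.
  mutual
    splitsT : Tree A → List (Tree A × Tree A)
    splitsT (node x ts) = map (λ p → (node x (proj₁ p) , proj₂ p)) (splitsF ts)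

    splitsF : Forest A → List (Forest A × Tree A)
    splitsF [] = []
    splitsF (t ∷ ts) =
      (ts , t) ∷
      (map (λ p → (proj₁ p ∷ ts , proj₂ p)) (splitsT t) ++
       map (λ p → (t ∷ proj₁ p , proj₂ p)) (splitsF ts))

  -- Binary tubings of a tube T (with fuel; fuel ≥ number of vertices of T
  -- suffices).  A binary tubing of T is {T} ∪ τ₁ ∪ τ₂ where T = T₁ ⊔ T₂ is
  -- a partition of T into two tubes and τᵢ is a binary tubing of Tᵢ.
  -- A tubing is a list of tubes; a tube is stored as the induced subtree,
  -- whose vertex set is verticesT and whose root (the vertex nearest to
  -- rt(t)) is rootLabel.
  tubingsN : ℕ → Tree A → List (List (Tree A))
  tubingsN zero _ = []
  tubingsN (suc n) (node x []) = (node x [] ∷ []) ∷ []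
  tubingsN (suc n) T@(node x (_ ∷ _)) =
    concatMap (λ p →
      concatMap (λ τ₁ → map (λ τ₂ → T ∷ (τ₁ ++ τ₂)) (tubingsN n (proj₂ p)))
                (tubingsN n (proj₁ p)))
      (splitsT T)

Tub : ∀ {d} {D : Set d} → Tree D → List (List (Tree (ℕ × D)))
Tub t = tubingsN (sizeT t) (labelled t)

bv : ∀ {d} {D : Set d} → ℕ → List (Tree (ℕ × D)) → ℕ
bv v τ = length (filter (λ T → proj₁ (rootLabel T) ≟ v) τ)

bτ : ∀ {d} {D : Set d} → Tree D → List (Tree (ℕ × D)) → ℕ
bτ t τ = bv (proj₁ (rootLabel (labelled t))) τ

nonRootVertices : ∀ {d} {D : Set d} → Tree D → List (ℕ × D)
nonRootVertices t with labelled t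
... | node _ us = verticesF us

module _ {a ℓ} (R : CommutativeRing a ℓ) where
  open CommutativeRing R

  sumK : List Carrier → Carrier
  sumK [] = 0#
  sumK (x ∷ xs) = x + sumK xs

  prodK : List Carrier → Carrier
  prodK [] = 1#
  prodK (x ∷ xs) = x * prodK xs

  module _ {d} {D : Set d} where

    -- A linear map H(D) → K, given by its values on the basis of forests.
    LinMap : Set (a ⊔ d)
    LinMap = Forest D → Carrier

    εK : LinMap
    εK [] = 1#
    εK (_ ∷ _) = 0#

    conv : LinMap → LinMap → LinMap
    conv α β F = sumK (map (λ p → α (proj₁ p) * β (proj₂ p)) (cutsF F))

    convPow : ℕ → LinMap → LinMap
    convPow zero α = εK
    convPow (suc k) α = conv α (convPow k α)

    module _ (c : ℕ → D → Carrier) where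

      cτ : Tree D → List (Tree (ℕ × D)) → Carrier
      cτ t τ = prodK (map (λ v → c (bv (proj₁ v) τ ∸ 1) (proj₂ v))
                          (nonRootVertices t))

      rootDec : Tree D → D
      rootDec (node x _) = x

      σTree : Tree D → Carrier
      σTree t = sumK (map (λ τ → c (bτ t τ ∸ 1) (rootDec t) * cτ t τ) (Tub t))

      σ : LinMap
      σ [] = 0#
      σ (t ∷ []) = σTree t
      σ (_ ∷ _ ∷ _) = 0#

      rhs : ℕ → Tree D → Carrier
      rhs k t = sumK (map (λ τ → c (bτ t τ ∸ k) (rootDec t) * cτ t τ)
                          (filter (λ τ → k Data.Nat.≤? bτ t τ) (Tub t)))

module Submission where

open import Level using (Level; _⊔_)
open import Data.Empty using (⊥-elim)
open import Data.Nat using (ℕ; zero; suc; _∸_; _≤_; _<_; _≟_; _≤?_; z≤n; s≤s)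
open import Data.Nat.Properties using (≤-refl; ≤-trans; <⇒≤; <-≤-trans; <-irrefl; m<m+n; m≤n+m)
open import Data.List using (List; []; _∷_; _++_; map; concatMap; filter; length)
open import Data.List.Properties
  using ( map-++; map-∘; map-cong-local; length-++; ++-identityʳ
        ; filter-++; filter-accept; filter-reject; filter-none )
open import Data.List.Membership.Propositional using (_∈_; _∉_)
open import Data.List.Membership.Propositional.Properties using (∈-map⁺; ∈-++⁺ˡ; ∈-++⁺ʳ)
open import Data.List.Relation.Binary.Disjoint.Propositional using (Disjoint)
open import Data.List.Relation.Binary.Permutation.Propositional as ↭
  using (_↭_; ↭-sym; ↭-trans; prep; ↭⇒↭ₛ)
import Data.List.Relation.Binary.Permutation.Propositional.Properties as ↭
import Data.List.Relation.Binary.Permutation.Setoid.Properties as ↭ₛ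
open import Data.List.Relation.Unary.All as All using (All; []; _∷_)
import Data.List.Relation.Unary.All.Properties as All
open import Data.List.Relation.Unary.AllPairs using ([]; _∷_)
open import Data.List.Relation.Unary.Any using (here; there)
open import Data.List.Relation.Unary.Unique.Propositional using (Unique)
import Data.List.Relation.Unary.Unique.Propositional.Properties as Unique
open import Data.Product using (_×_; _,_; proj₁; proj₂)
open import Function using (_∘_)
open import Relation.Nullary using (¬_; yes; no)
open import Relation.Unary using (Pred; Decidable)
import Relation.Binary.PropositionalEquality as ≡
open ≡ using (_≡_; _≢_)
open import Algebra.Bundles using (CommutativeRing)

open import Defs

-- Write  tubSum t α = Σ_{τ ∈ Tub t} α(b τ) c(τ).  A binary tubing of t is the
-- whole tube V(t), a split of it into an upper tube U ∋ rt(t) and a lower tube L, and binary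
-- tubings of U and L.  The root of t roots one tube more than in the tubing of U, and the root
-- of L contributes the factor c_{b-1, d(rt L)}, so
--     tubSum t α = Σ_{(U,L)} tubSum U (α ∘ suc) · σ(L).
-- On the other side σ vanishes off single trees, so by the shape of Δ
--     (σ * β)(t) = σ(t) β(1) + Σ_{(U,L)} σ(L) β(U)
-- over the same splits.  Taking α = c_{· - k, d(rt t)} (zero below k), both sides of the
-- theorem satisfy the same recursion in k, and they agree for k = 1 by definition of σ.

module _ {a b} {A : Set a} {B : Set b} (f : A → B) where
  open ≡ using (refl; sym; trans; cong; cong₂)

  mutual
    mapT : Tree A → Tree B
    mapT (node x ts) = node (f x) (mapF ts)

    mapF : Forest A → Forest B
    mapF [] = []
    mapF (t ∷ ts) = mapT t ∷ mapF ts

  mutual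
    splitsT-mapT : ∀ T → splitsT (mapT T) ≡ map (λ p → mapT (proj₁ p) , mapT (proj₂ p)) (splitsT T)
    splitsT-mapT (node x ts) = trans (cong (map _) (splitsF-mapF ts)) (trans (sym (map-∘ _)) (map-∘ _))

    splitsF-mapF : ∀ ts → splitsF (mapF ts) ≡ map (λ q → mapF (proj₁ q) , mapT (proj₂ q)) (splitsF ts)
    splitsF-mapF [] = refl
    splitsF-mapF (t ∷ ts) = cong ((mapF ts , mapT t) ∷_) (trans
      (cong₂ _++_ (trans (cong (map _) (splitsT-mapT t)) (trans (sym (map-∘ (splitsT t))) (map-∘ (splitsT t))))
                  (trans (cong (map _) (splitsF-mapF ts)) (trans (sym (map-∘ (splitsF ts))) (map-∘ (splitsF ts)))))
      (sym (map-++ (λ q → mapF (proj₁ q) , mapT (proj₂ q))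
                   (map cutFirst (splitsT t)) (map keepFirst (splitsF ts)))))
      where
      cutFirst : Tree A × Tree A → Forest A × Tree A
      cutFirst p = proj₁ p ∷ ts , proj₂ p
      keepFirst : Forest A × Tree A → Forest A × Tree A
      keepFirst q = t ∷ proj₁ q , proj₂ q

module _ {a} {A : Set a} where
  open ≡ using (refl; sym; trans; cong; cong₂; subst)
  open Data.Nat using (_+_)

  mutual
    splitsT-↭ : (T : Tree A) →
      All (λ p → verticesT T ↭ verticesT (proj₁ p) ++ verticesT (proj₂ p)) (splitsT T)
    splitsT-↭ (node x ts) = All.gmap⁺ (prep x) (splitsF-↭ ts)

    splitsF-↭ : (ts : Forest A) →
      All (λ q → verticesF ts ↭ verticesF (proj₁ q) ++ verticesT (proj₂ q)) (splitsF ts)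
    splitsF-↭ [] = []
    splitsF-↭ (t ∷ ts) =
      ↭.++-comm (verticesT t) (verticesF ts) ∷
      All.++⁺ (All.gmap⁺ (λ {p} → cutFirst (proj₁ p) (proj₂ p)) (splitsT-↭ t))
              (All.gmap⁺ (λ {q} → keepFirst (proj₁ q) (proj₂ q)) (splitsF-↭ ts))
      where
      cutFirst : ∀ U L → verticesT t ↭ verticesT U ++ verticesT L →
                 verticesT t ++ verticesF ts ↭ (verticesT U ++ verticesF ts) ++ verticesT L
      cutFirst U L split = ↭-trans (↭.++⁺ʳ (verticesF ts) split)
        (↭-trans (↭.++-assoc (verticesT U) (verticesT L) (verticesF ts))
        (↭-trans (↭.++⁺ˡ (verticesT U) (↭.++-comm (verticesT L) (verticesF ts)))
                 (↭-sym (↭.++-assoc (verticesT U) (verticesF ts) (verticesT L)))))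
      keepFirst : ∀ rest L → verticesF ts ↭ verticesF rest ++ verticesT L →
                  verticesT t ++ verticesF ts ↭ (verticesT t ++ verticesF rest) ++ verticesT L
      keepFirst rest L split = ↭-trans (↭.++⁺ˡ (verticesT t) split)
        (↭-sym (↭.++-assoc (verticesT t) (verticesF rest) (verticesT L)))

  mutual
    sizeT≡length : (T : Tree A) → sizeT T ≡ length (verticesT T)
    sizeT≡length (node x ts) = cong suc (sizeF≡length ts)

    sizeF≡length : (ts : Forest A) → sizeF ts ≡ length (verticesF ts)
    sizeF≡length [] = refl
    sizeF≡length (t ∷ ts) =
      trans (cong₂ _+_ (sizeT≡length t) (sizeF≡length ts)) (sym (length-++ (verticesT t)))

  splitsF-sizes : (us : Forest A) →
    All (λ q → suc (sizeF (proj₁ q)) ≤ sizeF us × sizeT (proj₂ q) ≤ sizeF us) (splitsF us)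
  splitsF-sizes us = All.map (λ {q} → bounds q) (splitsF-↭ us)
    where
    bounds : ∀ q → verticesF us ↭ verticesF (proj₁ q) ++ verticesT (proj₂ q) →
             suc (sizeF (proj₁ q)) ≤ sizeF us × sizeT (proj₂ q) ≤ sizeF us
    bounds (rest , L@(node _ _)) split =
      subst (suc (sizeF rest) ≤_) (sym size-us) (m<m+n (sizeF rest) (s≤s z≤n)) ,
      subst (sizeT L ≤_) (sym size-us) (m≤n+m (sizeT L) (sizeF rest))
      where
      size-us : sizeF us ≡ sizeF rest + sizeT L
      size-us = trans (sizeF≡length us) (trans (↭.↭-length split) (trans (length-++ (verticesF rest))
                  (sym (cong₂ _+_ (sizeF≡length rest) (sizeT≡length L)))))

Unique-++⁻ : ∀ {a} {A : Set a} (xs : List A) {ys : List A} → Unique (xs ++ ys) →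
             Unique xs × Unique ys × Disjoint xs ys
Unique-++⁻ [] unique = [] , unique , λ ()
Unique-++⁻ (x ∷ xs) (x∉ ∷ unique) with Unique-++⁻ xs unique | All.++⁻ xs x∉
... | unique₁ , unique₂ , disjoint | x∉xs , x∉ys =
  x∉xs ∷ unique₁ , unique₂ , λ where
    (here ≡.refl , x∈ys) → All.lookup x∉ys x∈ys ≡.refl
    (there v∈xs , v∈ys) → disjoint (v∈xs , v∈ys)

module Sums {a ℓ} (K : CommutativeRing a ℓ) where
  open CommutativeRing K

  private variable
    x y : Level
    X : Set x
    Y : Set y
  open import Relation.Binary.Reasoning.Setoid setoid
  open import Algebra.Properties.CommutativeSemigroup *-commutativeSemigroup using (x∙yz≈y∙xz)

  sumK-++ : (xs ys : List Carrier) → sumK K (xs ++ ys) ≈ sumK K xs + sumK K ys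
  sumK-++ [] ys = sym (+-identityˡ _)
  sumK-++ (x ∷ xs) ys = trans (+-congˡ (sumK-++ xs ys)) (sym (+-assoc _ _ _))

  prodK-++ : (xs ys : List Carrier) → prodK K (xs ++ ys) ≈ prodK K xs * prodK K ys
  prodK-++ [] ys = sym (*-identityˡ _)
  prodK-++ (x ∷ xs) ys = trans (*-congˡ (prodK-++ xs ys)) (sym (*-assoc _ _ _))

  prodK-↭ : {xs ys : List Carrier} → xs ↭ ys → prodK K xs ≈ prodK K ys
  prodK-↭ ↭.refl = refl
  prodK-↭ (↭.prep x h) = *-congˡ (prodK-↭ h)
  prodK-↭ (↭.swap x y h) = trans (*-congˡ (*-congˡ (prodK-↭ h))) (x∙yz≈y∙xz x y _)
  prodK-↭ (↭.trans h h′) = trans (prodK-↭ h) (prodK-↭ h′)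

  sumK-cong : {f g : X → Carrier} {xs : List X} → All (λ x → f x ≈ g x) xs →
              sumK K (map f xs) ≈ sumK K (map g xs)
  sumK-cong [] = refl
  sumK-cong (e ∷ es) = +-cong e (sumK-cong es)

  sumK-zero : {f : X → Carrier} (xs : List X) → (∀ x → f x ≈ 0#) → sumK K (map f xs) ≈ 0#
  sumK-zero [] _ = refl
  sumK-zero (x ∷ xs) e = trans (+-cong (e x) (sumK-zero xs e)) (+-identityˡ _)

  sumK-*ˡ : (c : Carrier) (f : X → Carrier) (xs : List X) →
            sumK K (map (λ x → c * f x) xs) ≈ c * sumK K (map f xs)
  sumK-*ˡ c f [] = sym (zeroʳ c)
  sumK-*ˡ c f (x ∷ xs) = trans (+-congˡ (sumK-*ˡ c f xs)) (sym (distribˡ c _ _))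

  sumK-*ʳ : (c : Carrier) (f : X → Carrier) (xs : List X) →
            sumK K (map (λ x → f x * c) xs) ≈ sumK K (map f xs) * c
  sumK-*ʳ c f [] = sym (zeroˡ c)
  sumK-*ʳ c f (x ∷ xs) = trans (+-congˡ (sumK-*ʳ c f xs)) (sym (distribʳ c _ _))

  sumK-filter : ∀ {p} {P : Pred X p} (P? : Decidable P) (f g : X → Carrier) (xs : List X) →
    (∀ x → P x → f x ≈ g x) → (∀ x → ¬ P x → g x ≈ 0#) →
    sumK K (map f (filter P? xs)) ≈ sumK K (map g xs)
  sumK-filter P? f g [] _ _ = refl
  sumK-filter P? f g (x ∷ xs) inside outside with P? x
  ... | yes p = +-cong (inside x p) (sumK-filter P? f g xs inside outside)
  ... | no ¬p = trans (sumK-filter P? f g xs inside outside)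
                      (sym (trans (+-congʳ (outside x ¬p)) (+-identityˡ _)))

  sumK-map-∘ : (f : Y → Carrier) (g : X → Y) (xs : List X) →
               sumK K (map f (map g xs)) ≈ sumK K (map (λ x → f (g x)) xs)
  sumK-map-∘ f g xs = reflexive (≡.cong (sumK K) (≡.sym (map-∘ xs)))

  sumK-concatMap : (f : Y → Carrier) (g : X → List Y) (xs : List X) →
    sumK K (map f (concatMap g xs)) ≈ sumK K (map (λ x → sumK K (map f (g x))) xs)
  sumK-concatMap f g [] = refl
  sumK-concatMap f g (x ∷ xs) = begin
    sumK K (map f (g x ++ concatMap g xs))               ≡⟨ ≡.cong (sumK K) (map-++ f (g x) (concatMap g xs)) ⟩
    sumK K (map f (g x) ++ map f (concatMap g xs))       ≈⟨ sumK-++ (map f (g x)) _ ⟩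
    sumK K (map f (g x)) + sumK K (map f (concatMap g xs)) ≈⟨ +-congˡ (sumK-concatMap f g xs) ⟩
    sumK K (map f (g x)) + sumK K (map (λ x → sumK K (map f (g x))) xs) ∎

  sumK-product : (f : X → Carrier) (g : Y → Carrier) (xs : List X) (ys : List Y) →
    sumK K (map (λ x → sumK K (map (λ y → f x * g y) ys)) xs) ≈ sumK K (map f xs) * sumK K (map g ys)
  sumK-product f g xs ys = begin
    sumK K (map (λ x → sumK K (map (λ y → f x * g y) ys)) xs)
      ≈⟨ sumK-cong (All.universal (λ x → sumK-*ˡ (f x) g ys) xs) ⟩
    sumK K (map (λ x → f x * sumK K (map g ys)) xs)
      ≈⟨ sumK-*ʳ _ f xs ⟩
    sumK K (map f xs) * sumK K (map g ys) ∎

module Coproduct {a ℓ} (K : CommutativeRing a ℓ) {d} {D : Set d} where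
  open CommutativeRing K
  open Sums K
  open import Relation.Binary.Reasoning.Setoid setoid
  open import Algebra.Properties.CommutativeSemigroup +-commutativeSemigroup using (x∙yz≈y∙xz)

  VanishesOnTwoTrees : (Forest D × Forest D → Carrier) → Set (ℓ ⊔ d)
  VanishesOnTwoTrees φ = ∀ s s′ f u → φ (s ∷ s′ ∷ f , u) ≈ 0#

  atSplit : (Forest D × Forest D → Carrier) → Forest D × Tree D → Carrier
  atSplit φ q = φ (proj₂ q ∷ [] , proj₁ q)

  -- A cut removing at most one tree is either the empty cut or the removal of the lower part
  -- of a split.
  mutual
    sum-cutsF : (F : Forest D) (φ : Forest D × Forest D → Carrier) → VanishesOnTwoTrees φ →
      sumK K (map φ (cutsF F)) ≈ φ ([] , F) + sumK K (map (atSplit φ) (splitsF F))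
    sum-cutsF [] φ _ = refl
    sum-cutsF (t@(node x ch) ∷ F) φ φ≈0 = begin
      sumK K (map φ (concatMap graft (cutsT t)))
        ≈⟨ sumK-concatMap φ graft (cutsT t) ⟩
      sumK K (map φ (graft (t ∷ [] , []))) + sumK K (map (λ p → sumK K (map φ (graft p))) (map lower (cutsF ch)))
        ≈⟨ +-cong (sumK-map-∘ φ _ (cutsF F))
                  (trans (sumK-map-∘ _ lower (cutsF ch))
                         (sumK-cong (All.universal (λ p → sumK-map-∘ φ (graftLower p) (cutsF F)) (cutsF ch)))) ⟩
      sumK K (map (λ q → φ (t ∷ proj₁ q , proj₂ q)) (cutsF F)) + sumK K (map ψ (cutsF ch))
        ≈⟨ +-cong (sum-cutsF-under t F φ φ≈0) (sum-cutsF ch ψ ψ≈0) ⟩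
      φ (t ∷ [] , F) + (ψ ([] , ch) + sumK K (map (atSplit ψ) (splitsF ch)))
        ≈⟨ +-congˡ (+-cong (sum-cutsF F (λ q → φ (proj₁ q , t ∷ proj₂ q))
                                         (λ s s′ f u → φ≈0 s s′ f (t ∷ u)))
                           (sumK-cong (All.universal under-lower (splitsF ch)))) ⟩
      φ (t ∷ [] , F) + ((φ ([] , t ∷ F) + S₂) + S₁)
        ≈⟨ trans (+-congˡ (trans (+-assoc _ S₂ S₁) (+-congˡ (+-comm S₂ S₁)))) (x∙yz≈y∙xz _ _ _) ⟩
      φ ([] , t ∷ F) + (φ (t ∷ [] , F) + (S₁ + S₂))
        ≈⟨ +-congˡ (+-congˡ (sym splits-sum)) ⟩
      φ ([] , t ∷ F) + sumK K (map (atSplit φ) (splitsF (t ∷ F))) ∎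
      where
      graft : Forest D × Forest D → List (Forest D × Forest D)
      graft p = map (λ q → proj₁ p ++ proj₁ q , proj₂ p ++ proj₂ q) (cutsF F)
      lower : Forest D × Forest D → Forest D × Forest D
      lower p = proj₁ p , node x (proj₂ p) ∷ []
      graftLower : Forest D × Forest D → Forest D × Forest D → Forest D × Forest D
      graftLower p q = proj₁ p ++ proj₁ q , node x (proj₂ p) ∷ proj₂ q
      ψ : Forest D × Forest D → Carrier
      ψ p = sumK K (map (λ q → φ (graftLower p q)) (cutsF F))
      ψ≈0 : VanishesOnTwoTrees ψ
      ψ≈0 s s′ f u = sumK-zero (cutsF F) (λ q → φ≈0 s s′ (f ++ proj₁ q) _)
      under-lower : ∀ q → atSplit ψ q ≈ φ (proj₂ q ∷ [] , node x (proj₁ q) ∷ F)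
      under-lower q = sum-cutsF-under (proj₂ q) F (λ p → φ (proj₁ p , node x (proj₁ q) ∷ proj₂ p))
                                      (λ s s′ f u → φ≈0 s s′ f _)
      cutFirst : Tree D × Tree D → Forest D × Tree D
      cutFirst p = proj₁ p ∷ F , proj₂ p
      keepFirst : Forest D × Tree D → Forest D × Tree D
      keepFirst q = t ∷ proj₁ q , proj₂ q
      S₁ = sumK K (map (λ q → φ (proj₂ q ∷ [] , node x (proj₁ q) ∷ F)) (splitsF ch))
      S₂ = sumK K (map (λ q → φ (proj₂ q ∷ [] , t ∷ proj₁ q)) (splitsF F))
      splits-sum : sumK K (map (atSplit φ) (map cutFirst (splitsT t) ++ map keepFirst (splitsF F))) ≈ S₁ + S₂
      splits-sum = begin
        sumK K (map (atSplit φ) (map cutFirst (splitsT t) ++ map keepFirst (splitsF F)))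
          ≡⟨ ≡.cong (sumK K) (map-++ (atSplit φ) (map cutFirst (splitsT t)) (map keepFirst (splitsF F))) ⟩
        sumK K (map (atSplit φ) (map cutFirst (splitsT t)) ++ map (atSplit φ) (map keepFirst (splitsF F)))
          ≈⟨ sumK-++ (map (atSplit φ) (map cutFirst (splitsT t))) _ ⟩
        sumK K (map (atSplit φ) (map cutFirst (splitsT t))) + sumK K (map (atSplit φ) (map keepFirst (splitsF F)))
          ≈⟨ +-cong (trans (sumK-map-∘ (atSplit φ) cutFirst (splitsT t)) (sumK-map-∘ _ _ (splitsF ch)))
                    (sumK-map-∘ (atSplit φ) keepFirst (splitsF F)) ⟩
        S₁ + S₂ ∎

    sum-cutsF-under : (s : Tree D) (F : Forest D) (φ : Forest D × Forest D → Carrier) → VanishesOnTwoTrees φ →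
      sumK K (map (λ q → φ (s ∷ proj₁ q , proj₂ q)) (cutsF F)) ≈ φ (s ∷ [] , F)
    sum-cutsF-under s F φ φ≈0 = begin
      sumK K (map (λ q → φ (s ∷ proj₁ q , proj₂ q)) (cutsF F))
        ≈⟨ sum-cutsF F (λ q → φ (s ∷ proj₁ q , proj₂ q)) (λ s′ s″ f → φ≈0 s s′ (s″ ∷ f)) ⟩
      φ (s ∷ [] , F) + sumK K (map (λ q → φ (s ∷ proj₂ q ∷ [] , proj₁ q)) (splitsF F))
        ≈⟨ +-congˡ (sumK-zero (splitsF F) (λ q → φ≈0 s (proj₂ q) [] (proj₁ q))) ⟩
      φ (s ∷ [] , F) + 0#
        ≈⟨ +-identityʳ _ ⟩
      φ (s ∷ [] , F) ∎

  convOverSplits : (α β : Forest D → Carrier) → D → Forest D → Carrier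
  convOverSplits α β x us = sumK K (map (λ q → α (proj₂ q ∷ []) * β (node x (proj₁ q) ∷ [])) (splitsF us))

  module _ (α β : Forest D → Carrier)
           (α[]≈0 : α [] ≈ 0#) (α≈0 : ∀ s s′ f → α (s ∷ s′ ∷ f) ≈ 0#) where

    conv-tree : (x : D) (us : Forest D) →
      conv K α β (node x us ∷ []) ≈
      α (node x us ∷ []) * β [] + convOverSplits α β x us
    conv-tree x us = begin
      sumK K (map φ (cutsF (t ∷ [])))
        ≈⟨ sum-cutsF (t ∷ []) φ (λ s s′ f u → trans (*-congʳ (α≈0 s s′ f)) (zeroˡ _)) ⟩
      α [] * β (t ∷ []) + (α (t ∷ []) * β [] + sumK K (map (atSplit φ) (map plant (splitsT t) ++ [])))
        ≈⟨ +-cong (trans (*-congʳ α[]≈0) (zeroˡ _)) (+-congˡ planted-splits) ⟩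
      0# + (α (t ∷ []) * β [] + convOverSplits α β x us)
        ≈⟨ +-identityˡ _ ⟩
      α (t ∷ []) * β [] + convOverSplits α β x us ∎
      where
      t = node x us
      φ : Forest D × Forest D → Carrier
      φ p = α (proj₁ p) * β (proj₂ p)
      plant : Tree D × Tree D → Forest D × Tree D
      plant p = proj₁ p ∷ [] , proj₂ p
      planted-splits : sumK K (map (atSplit φ) (map plant (splitsT t) ++ [])) ≈ convOverSplits α β x us
      planted-splits = begin
        sumK K (map (atSplit φ) (map plant (splitsT t) ++ []))
          ≡⟨ ≡.cong (λ qs → sumK K (map (atSplit φ) qs)) (++-identityʳ (map plant (splitsT t))) ⟩
        sumK K (map (atSplit φ) (map plant (splitsT t)))
          ≈⟨ trans (sumK-map-∘ (atSplit φ) plant (splitsT t)) (sumK-map-∘ _ _ (splitsF us)) ⟩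
        convOverSplits α β x us ∎

module _ {d} {D : Set d} where
  open ≡ using (refl; sym; trans; cong; cong₂; subst)
  open Data.Nat using (_+_)
  open Data.Nat.Properties using (+-identityʳ)

  labels : Tree (ℕ × D) → List ℕ
  labels T = map proj₁ (verticesT T)

  labelsF : Forest (ℕ × D) → List ℕ
  labelsF ts = map proj₁ (verticesF ts)

  labelsF-∷ : (u : Tree (ℕ × D)) (us : Forest (ℕ × D)) → labelsF (u ∷ us) ≡ labels u ++ labelsF us
  labelsF-∷ u us = map-++ proj₁ (verticesT u) (verticesF us)

  private
    Within : ℕ → ℕ → List ℕ → Set
    Within n m = All (λ l → n ≤ l × l < m)

  mutual
    labelT-unique : ∀ n (t : Tree D) → let (u , m) = labelT n t in
      n < m × Within n m (labels u) × Unique (labels u)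
    labelT-unique n (node x ts) with labelF-unique (suc n) ts
    ... | n<m , within , unique =
      n<m , (≤-refl , n<m) ∷ All.map (λ (n<l , l<m) → <⇒≤ n<l , l<m) within ,
      All.map (λ (n<l , _) n≡l → <-irrefl n≡l n<l) within ∷ unique

    labelF-unique : ∀ n (ts : Forest D) → let (us , m) = labelF n ts in
      n ≤ m × Within n m (labelsF us) × Unique (labelsF us)
    labelF-unique n [] = ≤-refl , [] , []
    labelF-unique n (t ∷ ts) with labelT-unique n t | labelF-unique (proj₂ (labelT n t)) ts
    ... | n<m , within₁ , unique₁ | m≤k , within₂ , unique₂ =
      ≤-trans (<⇒≤ n<m) m≤k ,
      subst (Within _ _) (sym (labelsF-∷ u us))
        (All.++⁺ (All.map (λ (n≤l , l<m) → n≤l , <-≤-trans l<m m≤k) within₁)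
                 (All.map (λ (m≤l , l<k) → ≤-trans (<⇒≤ n<m) m≤l , l<k) within₂)) ,
      subst Unique (sym (labelsF-∷ u us)) (Unique.++⁺ unique₁ unique₂ disjoint)
      where
      u = proj₁ (labelT n t)
      us = proj₁ (labelF (proj₂ (labelT n t)) ts)
      disjoint : ∀ {l} → ¬ (l ∈ labels u × l ∈ labelsF us)
      disjoint (l∈u , l∈us) =
        <-irrefl refl (<-≤-trans (proj₂ (All.lookup within₁ l∈u)) (proj₁ (All.lookup within₂ l∈us)))

  labelled-unique : (t : Tree D) → Unique (labels (labelled t))
  labelled-unique t = proj₂ (proj₂ (labelT-unique 0 t))

  mutual
    mapT-proj₂-labelT : ∀ n (t : Tree D) → mapT proj₂ (proj₁ (labelT n t)) ≡ t
    mapT-proj₂-labelT n (node x ts) = cong (node x) (mapF-proj₂-labelF (suc n) ts)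

    mapF-proj₂-labelF : ∀ n (ts : Forest D) → mapF proj₂ (proj₁ (labelF n ts)) ≡ ts
    mapF-proj₂-labelF n [] = refl
    mapF-proj₂-labelF n (t ∷ ts) = cong₂ _∷_ (mapT-proj₂-labelT n t) (mapF-proj₂-labelF _ ts)

  rootOf : Tree (ℕ × D) → ℕ
  rootOf T = proj₁ (rootLabel T)

  private
    rootedAt? = λ v (T : Tree (ℕ × D)) → rootOf T ≟ v

  bv-∷-root : (T : Tree (ℕ × D)) (τ : List (Tree (ℕ × D))) → bv (rootOf T) (T ∷ τ) ≡ suc (bv (rootOf T) τ)
  bv-∷-root T τ = cong length (filter-accept (rootedAt? (rootOf T)) {T} {τ} refl)

  bv-∷-other : ∀ {v} (T : Tree (ℕ × D)) (τ : List (Tree (ℕ × D))) → rootOf T ≢ v →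
               bv v (T ∷ τ) ≡ bv v τ
  bv-∷-other {v} T τ ≢v = cong length (filter-reject (rootedAt? v) {T} {τ} ≢v)

  bv-++ : ∀ v (τ₁ τ₂ : List (Tree (ℕ × D))) → bv v (τ₁ ++ τ₂) ≡ bv v τ₁ + bv v τ₂
  bv-++ v τ₁ τ₂ = trans (cong length (filter-++ (rootedAt? v) τ₁ τ₂)) (length-++ (filter (rootedAt? v) τ₁))

  RootedIn : Tree (ℕ × D) → List (Tree (ℕ × D)) → Set d
  RootedIn U τ = All (λ T → rootOf T ∈ labels U) τ

  bv-rootedIn : ∀ {v U τ} → RootedIn U τ → v ∉ labels U → bv v τ ≡ 0
  bv-rootedIn {v} {τ = τ} rooted v∉U =
    cong length (filter-none (rootedAt? v) {τ}
      (All.map (λ r∈U r≡v → v∉U (subst (_∈ labels _) r≡v r∈U)) rooted))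

  bv-++-rootedInʳ : ∀ {v L} τ₁ {τ₂} → RootedIn L τ₂ → v ∉ labels L → bv v (τ₁ ++ τ₂) ≡ bv v τ₁
  bv-++-rootedInʳ {v} τ₁ {τ₂} rooted v∉L =
    trans (bv-++ v τ₁ τ₂) (trans (cong (bv v τ₁ +_) (bv-rootedIn rooted v∉L)) (+-identityʳ _))

  bv-++-rootedInˡ : ∀ {v U τ₁} τ₂ → RootedIn U τ₁ → v ∉ labels U → bv v (τ₁ ++ τ₂) ≡ bv v τ₂
  bv-++-rootedInˡ {v} {τ₁ = τ₁} τ₂ rooted v∉U =
    trans (bv-++ v τ₁ τ₂) (cong (_+ bv v τ₂) (bv-rootedIn rooted v∉U))

  labels-↭ : ∀ T U L → verticesT T ↭ verticesT U ++ verticesT L → labels T ↭ labels U ++ labels L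
  labels-↭ T U L h = subst (_ ↭_) (map-++ proj₁ (verticesT U) (verticesT L)) (↭.map⁺ proj₁ h)

  tubingsN-rootedIn : ∀ n T → All (RootedIn T) (tubingsN n T)
  tubingsN-rootedIn zero T = []
  tubingsN-rootedIn (suc n) (node x []) = (here refl ∷ []) ∷ []
  tubingsN-rootedIn (suc n) T@(node x (_ ∷ _)) =
    All.concat⁺ (All.gmap⁺ (λ {p} h →
      All.concat⁺ (All.gmap⁺ (λ rooted₁ →
        All.gmap⁺ (λ rooted₂ → here refl ∷ All.++⁺ (All.map (⊆ˡ h) rooted₁) (All.map (⊆ʳ h) rooted₂))
          (tubingsN-rootedIn n (proj₂ p)))
        (tubingsN-rootedIn n (proj₁ p))))
      (splitsT-↭ T))
    where
    ⊆ˡ : ∀ {U L v} → verticesT T ↭ verticesT U ++ verticesT L → v ∈ labels U → v ∈ labels T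
    ⊆ˡ {U} {L} h v∈U = ↭.∈-resp-↭ (↭-sym (labels-↭ T U L h)) (∈-++⁺ˡ v∈U)
    ⊆ʳ : ∀ {U L v} → verticesT T ↭ verticesT U ++ verticesT L → v ∈ labels L → v ∈ labels T
    ⊆ʳ {U} {L} h v∈L = ↭.∈-resp-↭ (↭-sym (labels-↭ T U L h)) (∈-++⁺ʳ (labels U) v∈L)

-- Labels identify vertices, so when they are distinct the tubes of a tubing of one part of a
-- split do not affect b(v, -) at vertices v of the other part.
module Graft {d} {D : Set d} (x : ℕ × D) (us rest : Forest (ℕ × D)) (y : ℕ × D) (ls : Forest (ℕ × D))
             (split : verticesF us ↭ verticesF rest ++ verticesT (node y ls))
             (unique : Unique (labels (node x us))) where
  open ≡ using (refl; sym; trans; cong; subst)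

  private
    T = node x us
    U = node x rest
    L = node y ls

  unique-parts : Unique (labels U) × Unique (labels L) × Disjoint (labels U) (labels L)
  unique-parts = Unique-++⁻ (labels U)
    (↭ₛ.Unique-resp-↭ (≡.setoid ℕ) (↭⇒↭ₛ (labels-↭ T U L (prep x split))) unique)

  private
    disjoint : Disjoint (labels U) (labels L)
    disjoint = proj₂ (proj₂ unique-parts)

  module _ {τ₁ τ₂ : List (Tree (ℕ × D))} (rooted₁ : RootedIn U τ₁) (rooted₂ : RootedIn L τ₂) where

    bv-graft-root : bv (proj₁ x) (T ∷ τ₁ ++ τ₂) ≡ suc (bv (proj₁ x) τ₁)
    bv-graft-root = trans (bv-∷-root T (τ₁ ++ τ₂))
      (cong suc (bv-++-rootedInʳ {L = L} τ₁ rooted₂ (λ r∈L → disjoint (here refl , r∈L))))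

    bv-graft-upper : ∀ {v} → v ∈ labelsF rest → bv v (T ∷ τ₁ ++ τ₂) ≡ bv v τ₁
    bv-graft-upper v∈rest with unique-parts
    ... | r∉rest ∷ _ , _ , _ =
      trans (bv-∷-other T (τ₁ ++ τ₂) (All.lookup r∉rest v∈rest))
            (bv-++-rootedInʳ {L = L} τ₁ rooted₂ (λ v∈L → disjoint (there v∈rest , v∈L)))

    bv-graft-lower : ∀ {v} → v ∈ labels L → bv v (T ∷ τ₁ ++ τ₂) ≡ bv v τ₂
    bv-graft-lower v∈L =
      trans (bv-∷-other T (τ₁ ++ τ₂) (λ r≡v → disjoint (here refl , subst (_∈ labels L) (sym r≡v) v∈L)))
            (bv-++-rootedInˡ {U = U} τ₂ rooted₁ (λ v∈U → disjoint (v∈U , v∈L)))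

module TubingSums {a ℓ} (K : CommutativeRing a ℓ) {d} {D : Set d}
                  (c : ℕ → D → CommutativeRing.Carrier K) where
  open CommutativeRing K
  open Sums K
  open Coproduct K
  open import Relation.Binary.Reasoning.Setoid setoid

  rootWeight : Tree D → ℕ → Carrier
  rootWeight t b = c (b ∸ 1) (rootDec K c t)

  -- n is fuel; for n ≥ sizeT t this is Σ_{τ ∈ Tub t} α (b τ) · c(τ).
  tubSumN : ℕ → Tree D → (ℕ → Carrier) → Carrier
  tubSumN zero _ α = 0#
  tubSumN (suc n) (node x []) α = α 1
  tubSumN (suc n) (node x us@(_ ∷ _)) α = sumK K (map
    (λ q → tubSumN n (node x (proj₁ q)) (λ b → α (suc b)) * tubSumN n (proj₂ q) (rootWeight (proj₂ q)))
    (splitsF us))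

  tubSum : Tree D → (ℕ → Carrier) → Carrier
  tubSum t = tubSumN (sizeT t) t

  vertexWeight : List (Tree (ℕ × D)) → ℕ × D → Carrier
  vertexWeight τ v = c (bv (proj₁ v) τ ∸ 1) (proj₂ v)

  -- c(τ) on a labelled tree: cτ t τ is nonRootWeight (labelled t) τ.
  nonRootWeight : Tree (ℕ × D) → List (Tree (ℕ × D)) → Carrier
  nonRootWeight (node _ us) τ = prodK K (map (vertexWeight τ) (verticesF us))

  vertexWeights : Tree (ℕ × D) → List (Tree (ℕ × D)) → Carrier
  vertexWeights T τ = prodK K (map (vertexWeight τ) (verticesT T))

  module _ (x : ℕ × D) (us rest : Forest (ℕ × D)) (y : ℕ × D) (ls : Forest (ℕ × D))
           (split : verticesF us ↭ verticesF rest ++ verticesT (node y ls))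
           (unique : Unique (labels (node x us)))
           {τ₁ τ₂ : List (Tree (ℕ × D))}
           (rooted₁ : RootedIn (node x rest) τ₁) (rooted₂ : RootedIn (node y ls) τ₂) where

    open Graft x us rest y ls split unique

    nonRootWeight-graft :
      nonRootWeight (node x us) (node x us ∷ τ₁ ++ τ₂) ≈
      nonRootWeight (node x rest) τ₁ * vertexWeights (node y ls) τ₂
    nonRootWeight-graft = begin
      prodK K (map w (verticesF us))
        ≈⟨ prodK-↭ (↭.map⁺ w split) ⟩
      prodK K (map w (verticesF rest ++ verticesT L))
        ≡⟨ ≡.cong (prodK K) (map-++ w (verticesF rest) (verticesT L)) ⟩
      prodK K (map w (verticesF rest) ++ map w (verticesT L))
        ≈⟨ prodK-++ (map w (verticesF rest)) _ ⟩
      prodK K (map w (verticesF rest)) * prodK K (map w (verticesT L))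
        ≡⟨ ≡.cong₂ (λ ws ws′ → prodK K ws * prodK K ws′) upper lower ⟩
      prodK K (map (vertexWeight τ₁) (verticesF rest)) * prodK K (map (vertexWeight τ₂) (verticesT L)) ∎
      where
      L = node y ls
      w = vertexWeight (node x us ∷ τ₁ ++ τ₂)
      weight-≡ : ∀ τ′ {v} → bv (proj₁ v) (node x us ∷ τ₁ ++ τ₂) ≡ bv (proj₁ v) τ′ →
                 w v ≡ vertexWeight τ′ v
      weight-≡ τ′ {v} = ≡.cong (λ b → c (b ∸ 1) (proj₂ v))
      upper : map w (verticesF rest) ≡ map (vertexWeight τ₁) (verticesF rest)
      upper = map-cong-local (All.tabulate (λ v∈ →
                weight-≡ τ₁ (bv-graft-upper rooted₁ rooted₂ (∈-map⁺ proj₁ v∈))))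
      lower : map w (verticesT L) ≡ map (vertexWeight τ₂) (verticesT L)
      lower = map-cong-local (All.tabulate (λ v∈ →
                weight-≡ τ₂ (bv-graft-lower rooted₁ rooted₂ (∈-map⁺ proj₁ v∈))))

  sum-tubingsN≈tubSumN : ∀ n (T : Tree (ℕ × D)) → Unique (labels T) → (α : ℕ → Carrier) →
    sumK K (map (λ τ → α (bv (rootOf T) τ) * nonRootWeight T τ) (tubingsN n T)) ≈ tubSumN n (mapT proj₂ T) α
  sum-tubingsN≈tubSumN zero T _ α = refl
  sum-tubingsN≈tubSumN (suc n) T@(node x []) _ α =
    trans (+-identityʳ _) (trans (*-identityʳ _) (reflexive (≡.cong α (bv-∷-root T []))))
  sum-tubingsN≈tubSumN (suc n) T@(node x us@(_ ∷ _)) unique α = begin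
    sumK K (map term (concatMap grafts (map upper (splitsF us))))
      ≈⟨ sumK-concatMap term grafts (map upper (splitsF us)) ⟩
    sumK K (map (λ p → sumK K (map term (grafts p))) (map upper (splitsF us)))
      ≈⟨ sumK-map-∘ _ upper (splitsF us) ⟩
    sumK K (map (λ q → sumK K (map term (grafts (upper q)))) (splitsF us))
      ≈⟨ sumK-cong (All.map (λ {q} → split-sum q) (splitsF-↭ us)) ⟩
    sumK K (map (λ q → G (forget q)) (splitsF us))
      ≈⟨ sym (sumK-map-∘ G forget (splitsF us)) ⟩
    sumK K (map G (map forget (splitsF us)))
      ≡⟨ ≡.cong (λ qs → sumK K (map G qs)) (≡.sym (splitsF-mapF proj₂ us)) ⟩
    tubSumN (suc n) (mapT proj₂ T) α ∎
    where
    term : List (Tree (ℕ × D)) → Carrier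
    term τ = α (bv (proj₁ x) τ) * nonRootWeight T τ
    upper : Forest (ℕ × D) × Tree (ℕ × D) → Tree (ℕ × D) × Tree (ℕ × D)
    upper q = node x (proj₁ q) , proj₂ q
    grafts : Tree (ℕ × D) × Tree (ℕ × D) → List (List (Tree (ℕ × D)))
    grafts p = concatMap (λ τ₁ → map (λ τ₂ → T ∷ τ₁ ++ τ₂) (tubingsN n (proj₂ p)))
                         (tubingsN n (proj₁ p))
    forget : Forest (ℕ × D) × Tree (ℕ × D) → Forest D × Tree D
    forget q = mapF proj₂ (proj₁ q) , mapT proj₂ (proj₂ q)
    G : Forest D × Tree D → Carrier
    G q = tubSumN n (node (proj₂ x) (proj₁ q)) (λ b → α (suc b)) * tubSumN n (proj₂ q) (rootWeight (proj₂ q))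
    split-sum : ∀ q → verticesF us ↭ verticesF (proj₁ q) ++ verticesT (proj₂ q) →
                sumK K (map term (grafts (upper q))) ≈ G (forget q)
    split-sum (rest , L@(node y ls)) split = begin
      sumK K (map term (concatMap (λ τ₁ → map (λ τ₂ → T ∷ τ₁ ++ τ₂) (tubingsN n L)) (tubingsN n U)))
        ≈⟨ sumK-concatMap term (λ τ₁ → map (λ τ₂ → T ∷ τ₁ ++ τ₂) (tubingsN n L)) (tubingsN n U) ⟩
      sumK K (map (λ τ₁ → sumK K (map term (map (λ τ₂ → T ∷ τ₁ ++ τ₂) (tubingsN n L)))) (tubingsN n U))
        ≈⟨ sumK-cong (All.map (λ rooted₁ → trans (sumK-map-∘ term (λ τ₂ → T ∷ _ ++ τ₂) (tubingsN n L))
                                                (sumK-cong (All.map (term-graft rooted₁) (tubingsN-rootedIn n L))))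
                              (tubingsN-rootedIn n U)) ⟩
      sumK K (map (λ τ₁ → sumK K (map (λ τ₂ → upperTerm τ₁ * vertexWeights L τ₂) (tubingsN n L)))
                  (tubingsN n U))
        ≈⟨ sumK-product upperTerm (vertexWeights L) (tubingsN n U) (tubingsN n L) ⟩
      sumK K (map upperTerm (tubingsN n U)) * sumK K (map (vertexWeights L) (tubingsN n L))
        ≈⟨ *-cong (sum-tubingsN≈tubSumN n U uniqueU (λ b → α (suc b)))
                  (sum-tubingsN≈tubSumN n L uniqueL (λ b → c (b ∸ 1) (proj₂ y))) ⟩
      G (forget (rest , L)) ∎
      where
      U = node x rest
      open Graft x us rest y ls split unique
      uniqueU = proj₁ unique-parts
      uniqueL = proj₁ (proj₂ unique-parts)
      upperTerm : List (Tree (ℕ × D)) → Carrier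
      upperTerm τ₁ = α (suc (bv (proj₁ x) τ₁)) * nonRootWeight U τ₁
      term-graft : ∀ {τ₁ τ₂} → RootedIn U τ₁ → RootedIn L τ₂ →
                   term (T ∷ τ₁ ++ τ₂) ≈ upperTerm τ₁ * vertexWeights L τ₂
      term-graft rooted₁ rooted₂ = trans
        (*-cong (reflexive (≡.cong α (bv-graft-root rooted₁ rooted₂)))
                (nonRootWeight-graft x us rest y ls split unique rooted₁ rooted₂))
        (sym (*-assoc _ _ _))

  sum-Tub≈tubSum : (t : Tree D) (α : ℕ → Carrier) →
    sumK K (map (λ τ → α (bτ t τ) * cτ K c t τ) (Tub t)) ≈ tubSum t α
  sum-Tub≈tubSum t@(node _ _) α =
    trans (sum-tubingsN≈tubSumN (sizeT t) (labelled t) (labelled-unique t) α)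
          (reflexive (≡.cong (λ s → tubSumN (sizeT t) s α) (mapT-proj₂-labelT 0 t)))

  tubSumN-fuel : ∀ {m n} (t : Tree D) (α : ℕ → Carrier) → sizeT t ≤ m → sizeT t ≤ n →
                 tubSumN m t α ≈ tubSumN n t α
  tubSumN-fuel {zero} (node _ _) α () _
  tubSumN-fuel {suc m} {zero} (node _ _) α _ ()
  tubSumN-fuel {suc m} {suc n} (node x []) α _ _ = refl
  tubSumN-fuel {suc m} {suc n} (node x us@(_ ∷ _)) α (s≤s us≤m) (s≤s us≤n) =
    sumK-cong (All.map (λ (U≤us , L≤us) →
      *-cong (tubSumN-fuel (node x _) _ (≤-trans U≤us us≤m) (≤-trans U≤us us≤n))
             (tubSumN-fuel _ _ (≤-trans L≤us us≤m) (≤-trans L≤us us≤n))) (splitsF-sizes us))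

  tubSumN-cong : ∀ n (t : Tree D) {α β : ℕ → Carrier} → (∀ b → α (suc b) ≈ β (suc b)) →
                 tubSumN n t α ≈ tubSumN n t β
  tubSumN-cong zero t e = refl
  tubSumN-cong (suc n) (node x []) e = e 0
  tubSumN-cong (suc n) (node x us@(_ ∷ _)) e =
    sumK-cong (All.universal (λ q → *-congʳ (tubSumN-cong n (node x (proj₁ q)) (λ b → e (suc b)))) (splitsF us))

  tubSumOverSplits : D → Forest D → (ℕ → Carrier) → Carrier
  tubSumOverSplits x us β = sumK K (map
    (λ q → tubSum (node x (proj₁ q)) β * tubSum (proj₂ q) (rootWeight (proj₂ q)))
    (splitsF us))

  tubSum-unfold : (x : D) (us : Forest D) (α : ℕ → Carrier) → α 1 ≈ 0# →
    tubSum (node x us) α ≈ tubSumOverSplits x us (λ b → α (suc b))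
  tubSum-unfold x [] α α1≈0 = α1≈0
  tubSum-unfold x us@(_ ∷ _) α _ = sumK-cong (All.map (λ (U≤us , L≤us) →
    *-cong (tubSumN-fuel (node x _) _ U≤us ≤-refl) (tubSumN-fuel _ _ L≤us ≤-refl)) (splitsF-sizes us))

  shiftedWeight : ℕ → D → ℕ → Carrier
  shiftedWeight zero x b = c b x
  shiftedWeight (suc k) x zero = 0#
  shiftedWeight (suc k) x (suc b) = shiftedWeight k x b

  shiftedWeight-≤ : ∀ k x {b} → k ≤ b → shiftedWeight k x b ≡ c (b ∸ k) x
  shiftedWeight-≤ zero x _ = ≡.refl
  shiftedWeight-≤ (suc k) x (s≤s k≤b) = shiftedWeight-≤ k x k≤b

  shiftedWeight-≰ : ∀ k x {b} → ¬ k ≤ b → shiftedWeight k x b ≡ 0#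
  shiftedWeight-≰ zero x k≰b = ⊥-elim (k≰b z≤n)
  shiftedWeight-≰ (suc k) x {zero} _ = ≡.refl
  shiftedWeight-≰ (suc k) x {suc b} k≰b = shiftedWeight-≰ k x (k≰b ∘ s≤s)

  rhs≈tubSum : ∀ k (t : Tree D) → rhs K c k t ≈ tubSum t (shiftedWeight k (rootDec K c t))
  rhs≈tubSum k t = trans
    (sumK-filter (λ τ → k ≤? bτ t τ) _ (λ τ → shiftedWeight k x (bτ t τ) * cτ K c t τ) (Tub t)
      (λ τ k≤b → *-congʳ (reflexive (≡.sym (shiftedWeight-≤ k x k≤b))))
      (λ τ k≰b → trans (*-congʳ (reflexive (shiftedWeight-≰ k x k≰b))) (zeroˡ _)))
    (sum-Tub≈tubSum t (shiftedWeight k x))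
    where
    x = rootDec K c t

  σTree≈tubSum : (t : Tree D) → σTree K c t ≈ tubSum t (rootWeight t)
  σTree≈tubSum t = sum-Tub≈tubSum t (rootWeight t)

  convPow-σ : ∀ k (t : Tree D) →
    convPow K (suc k) (σ K c) (t ∷ []) ≈ tubSum t (shiftedWeight (suc k) (rootDec K c t))
  convPow-σ zero t@(node x us) = begin
    conv K (σ K c) (εK K) (t ∷ [])
      ≈⟨ conv-tree (σ K c) (εK K) refl (λ _ _ _ → refl) x us ⟩
    σTree K c t * 1# + sumK K (map (λ q → σTree K c (proj₂ q) * 0#) (splitsF us))
      ≈⟨ +-cong (*-identityʳ _) (sumK-zero (splitsF us) (λ _ → zeroʳ _)) ⟩
    σTree K c t + 0#
      ≈⟨ +-identityʳ _ ⟩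
    σTree K c t
      ≈⟨ σTree≈tubSum t ⟩
    tubSum t (rootWeight t)
      ≈⟨ tubSumN-cong (sizeT t) t (λ _ → refl) ⟩
    tubSum t (shiftedWeight 1 x) ∎
  convPow-σ (suc k) t@(node x us) = begin
    conv K (σ K c) P (t ∷ [])
      ≈⟨ conv-tree (σ K c) P refl (λ _ _ _ → refl) x us ⟩
    σTree K c t * P [] + convOverSplits (σ K c) P x us
      ≈⟨ +-cong (trans (*-congˡ P[]≈0) (zeroʳ _)) (sumK-cong (All.universal split-term (splitsF us))) ⟩
    0# + tubSumOverSplits x us (shiftedWeight (suc k) x)
      ≈⟨ +-identityˡ _ ⟩
    tubSumOverSplits x us (shiftedWeight (suc k) x)
      ≈⟨ sym (tubSum-unfold x us (shiftedWeight (suc (suc k)) x) refl) ⟩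
    tubSum t (shiftedWeight (suc (suc k)) x) ∎
    where
    P = convPow K (suc k) (σ K c)
    P[]≈0 : P [] ≈ 0#
    P[]≈0 = trans (+-identityʳ _) (zeroˡ _)
    split-term : ∀ q → σTree K c (proj₂ q) * P (node x (proj₁ q) ∷ []) ≈
      tubSum (node x (proj₁ q)) (shiftedWeight (suc k) x) * tubSum (proj₂ q) (rootWeight (proj₂ q))
    split-term q = trans (*-cong (σTree≈tubSum (proj₂ q)) (convPow-σ k (node x (proj₁ q)))) (*-comm _ _)

lemma4p3 : ∀ {a ℓ} (K : CommutativeRing a ℓ) → QAlgebra K →
           (D : Set) (c : ℕ → D → CommutativeRing.Carrier K) →
           (t : Tree D) (k : ℕ) → 1 ≤ k →
           CommutativeRing._≈_ K (convPow K k (σ K c) (t ∷ [])) (rhs K c k t)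
lemma4p3 K _ D c t zero ()
lemma4p3 K _ D c t (suc k) _ = trans (convPow-σ k t) (sym (rhs≈tubSum (suc k) t))
  where
  open CommutativeRing K using (trans; sym)
  open TubingSums K c
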